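{- Let $b\ge1$ be an integer, $a=2b+1$ and $e=a-2b=1$. Let $n=2m+1$ be odd with $b\ge em$, and let $\varphi$ be a $(2b+1,b)$-coloring of the path $P^n$ such that $\varphi(0)$ and $\varphi(n)$ are $n$-exactly-compatible. Then for every $k\in\{0,\ldots,n\}$: if $k=2s$ then $c(k)=(e(m-s),\ b-em,\ 0,\ es)$, and if $k=2s+1$ then $c(k)=(es,\ 0,\ b-em,\ e(m-s))$.
   Context: An $(a,b)$-coloring of a graph assigns to each vertex a $b$-element subset of $\{1,\ldots,a\}$ so that adjacent vertices get disjoint sets. $P^n$ has vertices $0,\ldots,n$ and edges $i(i+1)$. A good set is a $b$-subset of $\{1,\ldots,a\}$. Good sets $X,Y$ are $k$-exactly-compatible if $|X\cap Y|=b-e\frac{k}{2}$ when $k$ is even and $|X\cap Y|=e\frac{k-1}{2}$ when $k$ is odd. With $C_0=\varphi(0)$, $C_n=\varphi(n)$ set $C(1)=C_0\cap C_n$, $C(2)=C_0\setminus C_n$, $C(3)=C_n\setminus C_0$, $C(4)=\{1,\ldots,a\}\setminus(C_0\cup C_n)$, and $c(j,k)=|\varphi(k)\cap C(j)|$, $c(k)=(c(1,k),c(2,k),c(3,k),c(4,k))$. -}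

module Defs where

open import Data.Nat using (ℕ; zero; suc; _+_; _*_; _∸_; ⌊_/2⌋)
open import Data.Bool using (Bool; true; false)
open import Data.Product using (_×_)
open import Data.Fin using (Fin; zero; suc; inject₁; fromℕ)
open import Data.Fin.Subset using (Subset; _∩_; _∪_; _─_; ∁; ∣_∣; Empty)
open import Data.Vec using (Vec; tabulate)
open import Relation.Binary.PropositionalEquality using (_≡_)

-- Colours {1,…,a} are modelled as Fin a; subsets of colours as Subset a.

GoodSet : (a b : ℕ) → Subset a → Set
GoodSet a b X = ∣ X ∣ ≡ b

IsColoring : (a b n : ℕ) → (Fin (suc n) → Subset a) → Set
IsColoring a b n φ =
  ((i : Fin (suc n)) → GoodSet a b (φ i)) ×
  ((i : Fin n) → Empty (φ (inject₁ i) ∩ φ (suc i)))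

eOf : (a b : ℕ) → ℕ
eOf a b = a ∸ 2 * b

isEven : ℕ → Bool
isEven zero = true
isEven (suc zero) = false
isEven (suc (suc n)) = isEven n

-- X, Y are k-exactly-compatible:
--   k even: |X ∩ Y| = b - e(k/2)   (stated additively to avoid truncated subtraction)
--   k odd : |X ∩ Y| = e(k-1)/2
ExactlyCompatible : (a b k : ℕ) → Subset a → Subset a → Set
ExactlyCompatible a b k X Y with isEven k
... | true  = ∣ X ∩ Y ∣ + eOf a b * ⌊ k /2⌋ ≡ b
... | false = ∣ X ∩ Y ∣ ≡ eOf a b * ⌊ k /2⌋

-- The four regions C(1),…,C(4) (indexed by Fin 4 = 0,1,2,3) determined by C₀ = φ(0), Cₙ = φ(n).
region : {a n : ℕ} → (Fin (suc n) → Subset a) → Fin 4 → Subset a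
region {n = n} φ zero = φ zero ∩ φ (fromℕ n)
region {n = n} φ (suc zero) = φ zero ─ φ (fromℕ n)
region {n = n} φ (suc (suc zero)) = φ (fromℕ n) ─ φ zero
region {n = n} φ (suc (suc (suc zero))) = ∁ (φ zero ∪ φ (fromℕ n))

cvec : {a n : ℕ} → (Fin (suc n) → Subset a) → Fin (suc n) → Vec ℕ 4
cvec φ k = tabulate (λ j → ∣ φ k ∩ region φ j ∣)

-- Let A = φ 0 and B = φ n, so |A ∩ B| = m. For any b-set Z, the sets φ t ∩ Z and φ (t+1) ∩ Z
-- are disjoint in Z, and φ t ─ Z and φ (t+1) ─ Z are disjoint in ∁ Z, which has b + 1 elements;
-- so the traces |φ t ∩ Z| of adjacent vertices sum to b or b − 1. Running from |φ 0 ∩ Z| to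
-- |φ n ∩ Z| in an odd number n = 2m + 1 of steps, the traces of Z = A and of Z = B are forced to
-- alternate between sums b and b − 1, which fixes c(1,k) + c(2,k) and c(1,k) + c(3,k).
-- Counting inside B ─ A (of size b − m) across the edge from 2s to 2s + 1 then forces
-- c(3,2s) = c(2,2s+1) = 0, and the rest is linear arithmetic.
module Submission where

open import Defs
import Algebra.Lattice.Properties.BooleanAlgebra as BooleanAlgebraProperties
open import Data.Bool using (true; false)
open import Data.Empty using (⊥-elim)
open import Data.Fin using (Fin; zero; suc; toℕ; fromℕ; fromℕ<)
open import Data.Fin.Properties using (toℕ-fromℕ; toℕ-fromℕ<; toℕ-inject₁; toℕ≤pred[n])
open import Data.Fin.Subset using (Subset; inside; outside; _∩_; _∪_; _─_; ∁; ∣_∣; Empty)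
open import Data.Fin.Subset.Properties
  using (drop-∷-Empty; ∣p∣≤∣x∷p∣; ∣∁p∣≡n∸∣p∣; ∩-assoc; ∩-comm; ∩-idem; ∪-∩-booleanAlgebra)
open import Data.Nat using (ℕ; zero; suc; _+_; _*_; _∸_; _≤_; _<_; z≤n; s≤s; ⌊_/2⌋; z<s; _≤‴_; ≤‴-step; ≤‴-refl)
open import Data.Nat.Properties
open import Data.Nat.Tactic.RingSolver using (solve-∀)
open import Algebra.Properties.CommutativeSemigroup +-commutativeSemigroup using (interchange)
open import Data.Product using (_×_; _,_; proj₁; proj₂)
open import Data.Vec using (_∷_; []; here)
open import Relation.Binary.PropositionalEquality

private
  variable
    n : ℕ

p─q≡p∩∁q : (p q : Subset n) → p ─ q ≡ p ∩ ∁ q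
p─q≡p∩∁q []            []            = refl
p─q≡p∩∁q (inside  ∷ p) (inside  ∷ q) = cong (outside ∷_) (p─q≡p∩∁q p q)
p─q≡p∩∁q (inside  ∷ p) (outside ∷ q) = cong (inside ∷_) (p─q≡p∩∁q p q)
p─q≡p∩∁q (outside ∷ p) (inside  ∷ q) = cong (outside ∷_) (p─q≡p∩∁q p q)
p─q≡p∩∁q (outside ∷ p) (outside ∷ q) = cong (outside ∷_) (p─q≡p∩∁q p q)

∣p∩q∣+∣p∩∁q∣≡∣p∣ : (p q : Subset n) → ∣ p ∩ q ∣ + ∣ p ∩ ∁ q ∣ ≡ ∣ p ∣
∣p∩q∣+∣p∩∁q∣≡∣p∣ []            []            = refl
∣p∩q∣+∣p∩∁q∣≡∣p∣ (outside ∷ p) (_       ∷ q) = ∣p∩q∣+∣p∩∁q∣≡∣p∣ p q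
∣p∩q∣+∣p∩∁q∣≡∣p∣ (inside  ∷ p) (inside  ∷ q) = cong suc (∣p∩q∣+∣p∩∁q∣≡∣p∣ p q)
∣p∩q∣+∣p∩∁q∣≡∣p∣ (inside  ∷ p) (outside ∷ q) =
  trans (+-suc ∣ p ∩ q ∣ _) (cong suc (∣p∩q∣+∣p∩∁q∣≡∣p∣ p q))

∣p∩r∣+∣q∩r∣≤∣r∣ : (p q r : Subset n) → Empty (p ∩ q) → ∣ p ∩ r ∣ + ∣ q ∩ r ∣ ≤ ∣ r ∣
∣p∩r∣+∣q∩r∣≤∣r∣ [] [] [] _ = z≤n
∣p∩r∣+∣q∩r∣≤∣r∣ (inside ∷ p) (inside ∷ q) (_ ∷ r) p∩q=∅ = ⊥-elim (p∩q=∅ (zero , here))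
∣p∩r∣+∣q∩r∣≤∣r∣ (outside ∷ p) (outside ∷ q) (z ∷ r) p∩q=∅ =
  ≤-trans (∣p∩r∣+∣q∩r∣≤∣r∣ p q r (drop-∷-Empty p∩q=∅)) (∣p∣≤∣x∷p∣ z r)
∣p∩r∣+∣q∩r∣≤∣r∣ (inside ∷ p) (outside ∷ q) (inside ∷ r) p∩q=∅ =
  s≤s (∣p∩r∣+∣q∩r∣≤∣r∣ p q r (drop-∷-Empty p∩q=∅))
∣p∩r∣+∣q∩r∣≤∣r∣ (inside ∷ p) (outside ∷ q) (outside ∷ r) p∩q=∅ =
  ∣p∩r∣+∣q∩r∣≤∣r∣ p q r (drop-∷-Empty p∩q=∅)
∣p∩r∣+∣q∩r∣≤∣r∣ (outside ∷ p) (inside ∷ q) (inside ∷ r) p∩q=∅ =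
  subst (_≤ suc ∣ r ∣) (sym (+-suc ∣ p ∩ r ∣ ∣ q ∩ r ∣))
    (s≤s (∣p∩r∣+∣q∩r∣≤∣r∣ p q r (drop-∷-Empty p∩q=∅)))
∣p∩r∣+∣q∩r∣≤∣r∣ (outside ∷ p) (inside ∷ q) (outside ∷ r) p∩q=∅ =
  ∣p∩r∣+∣q∩r∣≤∣r∣ p q r (drop-∷-Empty p∩q=∅)

∣x∩[p∩q]∣+∣x∩[p∩∁q]∣≡∣x∩p∣ : (x p q : Subset n) → ∣ x ∩ (p ∩ q) ∣ + ∣ x ∩ (p ∩ ∁ q) ∣ ≡ ∣ x ∩ p ∣
∣x∩[p∩q]∣+∣x∩[p∩∁q]∣≡∣x∩p∣ x p q = begin
  ∣ x ∩ (p ∩ q) ∣ + ∣ x ∩ (p ∩ ∁ q) ∣   ≡⟨ cong₂ (λ u v → ∣ u ∣ + ∣ v ∣) (∩-assoc x p q) (∩-assoc x p (∁ q)) ⟨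
  ∣ (x ∩ p) ∩ q ∣ + ∣ (x ∩ p) ∩ ∁ q ∣   ≡⟨ ∣p∩q∣+∣p∩∁q∣≡∣p∣ (x ∩ p) q ⟩
  ∣ x ∩ p ∣                             ∎
  where open ≡-Reasoning

∣x∩[p∩q]∣+∣x∩[p─q]∣≡∣x∩p∣ : (x p q : Subset n) → ∣ x ∩ (p ∩ q) ∣ + ∣ x ∩ (p ─ q) ∣ ≡ ∣ x ∩ p ∣
∣x∩[p∩q]∣+∣x∩[p─q]∣≡∣x∩p∣ x p q rewrite p─q≡p∩∁q p q = ∣x∩[p∩q]∣+∣x∩[p∩∁q]∣≡∣x∩p∣ x p q

∣x∩[p∩q]∣+∣x∩[q─p]∣≡∣x∩q∣ : (x p q : Subset n) → ∣ x ∩ (p ∩ q) ∣ + ∣ x ∩ (q ─ p) ∣ ≡ ∣ x ∩ q ∣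
∣x∩[p∩q]∣+∣x∩[q─p]∣≡∣x∩q∣ x p q rewrite ∩-comm p q = ∣x∩[p∩q]∣+∣x∩[p─q]∣≡∣x∩p∣ x q p

∣x∩[q─p]∣+∣x∩∁[p∪q]∣≡∣x∩∁p∣ : (x p q : Subset n) → ∣ x ∩ (q ─ p) ∣ + ∣ x ∩ ∁ (p ∪ q) ∣ ≡ ∣ x ∩ ∁ p ∣
∣x∩[q─p]∣+∣x∩∁[p∪q]∣≡∣x∩∁p∣ {n} x p q
  rewrite p─q≡p∩∁q q p | ∩-comm q (∁ p) | BooleanAlgebraProperties.deMorgan₂ (∪-∩-booleanAlgebra n) p q =
  ∣x∩[p∩q]∣+∣x∩[p∩∁q]∣≡∣x∩p∣ x (∁ p) q

∣x∩[p∩q]∣+∣x∩[p─q]∣+∣x∩[q─p]∣+∣x∩∁[p∪q]∣≡∣x∣ : (x p q : Subset n) →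
  ∣ x ∩ (p ∩ q) ∣ + ∣ x ∩ (p ─ q) ∣ + ∣ x ∩ (q ─ p) ∣ + ∣ x ∩ ∁ (p ∪ q) ∣ ≡ ∣ x ∣
∣x∩[p∩q]∣+∣x∩[p─q]∣+∣x∩[q─p]∣+∣x∩∁[p∪q]∣≡∣x∣ x p q = begin
  ∣ x ∩ (p ∩ q) ∣ + ∣ x ∩ (p ─ q) ∣ + ∣ x ∩ (q ─ p) ∣ + ∣ x ∩ ∁ (p ∪ q) ∣
    ≡⟨ +-assoc (∣ x ∩ (p ∩ q) ∣ + ∣ x ∩ (p ─ q) ∣) _ _ ⟩
  (∣ x ∩ (p ∩ q) ∣ + ∣ x ∩ (p ─ q) ∣) + (∣ x ∩ (q ─ p) ∣ + ∣ x ∩ ∁ (p ∪ q) ∣)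
    ≡⟨ cong₂ _+_ (∣x∩[p∩q]∣+∣x∩[p─q]∣≡∣x∩p∣ x p q) (∣x∩[q─p]∣+∣x∩∁[p∪q]∣≡∣x∩∁p∣ x p q) ⟩
  ∣ x ∩ p ∣ + ∣ x ∩ ∁ p ∣
    ≡⟨ ∣p∩q∣+∣p∩∁q∣≡∣p∣ x p ⟩
  ∣ x ∣ ∎
  where open ≡-Reasoning

∣∁p∣≡1+b : ∀ {b} {p : Subset (2 * b + 1)} → ∣ p ∣ ≡ b → ∣ ∁ p ∣ ≡ suc b
∣∁p∣≡1+b {b} {p} ∣p∣≡b = begin
  ∣ ∁ p ∣             ≡⟨ ∣∁p∣≡n∸∣p∣ p ⟩
  2 * b + 1 ∸ ∣ p ∣   ≡⟨ cong₂ _∸_ (2b+1≡b+[1+b] b) ∣p∣≡b ⟩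
  b + suc b ∸ b       ≡⟨ m+n∸m≡n b (suc b) ⟩
  suc b               ∎
  where
  open ≡-Reasoning
  2b+1≡b+[1+b] : ∀ b → 2 * b + 1 ≡ b + suc b
  2b+1≡b+[1+b] = solve-∀

-- x and y are also disjoint inside ∁ z, which has b + 1 elements.
b≤1+∣x∩z∣+∣y∩z∣ : ∀ {b} {x y z : Subset (2 * b + 1)} → ∣ x ∣ ≡ b → ∣ y ∣ ≡ b → ∣ z ∣ ≡ b →
                  Empty (x ∩ y) → b ≤ suc (∣ x ∩ z ∣ + ∣ y ∩ z ∣)
b≤1+∣x∩z∣+∣y∩z∣ {b} {x} {y} {z} ∣x∣≡b ∣y∣≡b ∣z∣≡b x∩y=∅ = +-cancelʳ-≤ b b (suc (x₁ + y₁)) (begin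
  b + b                  ≡⟨ cong₂ _+_ x₁+x₂≡b y₁+y₂≡b ⟨
  (x₁ + x₂) + (y₁ + y₂)  ≡⟨ interchange x₁ x₂ y₁ y₂ ⟩
  (x₁ + y₁) + (x₂ + y₂)  ≤⟨ +-monoʳ-≤ (x₁ + y₁) x₂+y₂≤1+b ⟩
  (x₁ + y₁) + suc b      ≡⟨ +-suc (x₁ + y₁) b ⟩
  suc (x₁ + y₁) + b      ∎)
  where
  open ≤-Reasoning
  x₁ x₂ y₁ y₂ : ℕ
  x₁ = ∣ x ∩ z ∣
  x₂ = ∣ x ∩ ∁ z ∣
  y₁ = ∣ y ∩ z ∣
  y₂ = ∣ y ∩ ∁ z ∣
  x₁+x₂≡b : x₁ + x₂ ≡ b
  x₁+x₂≡b = trans (∣p∩q∣+∣p∩∁q∣≡∣p∣ x z) ∣x∣≡b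
  y₁+y₂≡b : y₁ + y₂ ≡ b
  y₁+y₂≡b = trans (∣p∩q∣+∣p∩∁q∣≡∣p∣ y z) ∣y∣≡b
  x₂+y₂≤1+b : x₂ + y₂ ≤ suc b
  x₂+y₂≤1+b = subst (x₂ + y₂ ≤_) (∣∁p∣≡1+b {p = z} ∣z∣≡b) (∣p∩r∣+∣q∩r∣≤∣r∣ x y (∁ z) x∩y=∅)

clamp : (n t : ℕ) → Fin (suc n)
clamp zero    _       = zero
clamp (suc n) zero    = zero
clamp (suc n) (suc t) = suc (clamp n t)

clamp-toℕ : (i : Fin (suc n)) → clamp n (toℕ i) ≡ i
clamp-toℕ {zero}  zero    = refl
clamp-toℕ {suc n} zero    = refl
clamp-toℕ {suc n} (suc i) = cong suc (clamp-toℕ i)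

clamp-adjacent-disjoint : ∀ {a b} (φ : Fin (suc n) → Subset a) → IsColoring a b n φ →
                          ∀ {t} → t < n → Empty (φ (clamp n t) ∩ φ (clamp n (suc t)))
clamp-adjacent-disjoint {n} φ col {t} t<n =
  subst₂ (λ u v → Empty (φ u ∩ φ v))
    (clamp-at (trans (toℕ-inject₁ i) (toℕ-fromℕ< t<n))) (clamp-at (cong suc (toℕ-fromℕ< t<n)))
    (proj₂ col i)
  where
  i : Fin n
  i = fromℕ< t<n
  clamp-at : ∀ {j : Fin (suc n)} {u} → toℕ j ≡ u → j ≡ clamp n u
  clamp-at {j} refl = sym (clamp-toℕ j)

-- E and O are the even- and odd-indexed terms of one sequence E 0, O 0, E 1, O 1, …, O m.
-- Induction forward from E 0 bounds O from above, induction backward from O m bounds it below.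
module Interleaved {b p m : ℕ} (E O : ℕ → ℕ)
  (E+O≤b    : ∀ {s} → s ≤ m → E s + O s ≤ b)
  (b≤1+O+E  : ∀ {s} → s < m → b ≤ suc (O s + E (suc s)))
  (E₀+p≡b   : E 0 + p ≡ b)
  (Oₘ≡p+m   : O m ≡ p + m)
  where

  open ≤-Reasoning

  b≤E+s+p : ∀ s → s ≤ m → b ≤ E s + s + p
  O≤p+s   : ∀ s → s ≤ m → O s ≤ p + s

  b≤E+s+p zero    _   = ≤-reflexive (trans (sym E₀+p≡b) (cong (_+ p) (sym (+-identityʳ (E 0)))))
  b≤E+s+p (suc s) s<m = begin
    b                        ≤⟨ b≤1+O+E s<m ⟩
    suc (O s + E (suc s))    ≤⟨ s≤s (+-monoˡ-≤ (E (suc s)) (O≤p+s s (<⇒≤ s<m))) ⟩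
    suc (p + s + E (suc s))  ≡⟨ rearrange p s (E (suc s)) ⟩
    E (suc s) + suc s + p    ∎
    where
    rearrange : ∀ p s e → suc (p + s + e) ≡ e + suc s + p
    rearrange = solve-∀

  O≤p+s s s≤m = +-cancelˡ-≤ (E s) (O s) (p + s) (begin
    E s + O s        ≤⟨ E+O≤b s≤m ⟩
    b                ≤⟨ b≤E+s+p s s≤m ⟩
    E s + s + p      ≡⟨ +-assoc (E s) s p ⟩
    E s + (s + p)    ≡⟨ cong (E s +_) (+-comm s p) ⟩
    E s + (p + s)    ∎)

  p+s≤O : ∀ {s} → s ≤‴ m → p + s ≤ O s
  p+s≤O ≤‴-refl             = ≤-reflexive (sym Oₘ≡p+m)
  p+s≤O {s} (≤‴-step 1+s≤m) = +-cancelˡ-≤ (E (suc s)) (p + s) (O s) (≤-pred (begin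
    suc (E (suc s) + (p + s))  ≡⟨ +-suc (E (suc s)) (p + s) ⟨
    E (suc s) + suc (p + s)    ≡⟨ cong (E (suc s) +_) (+-suc p s) ⟨
    E (suc s) + (p + suc s)    ≤⟨ +-monoʳ-≤ (E (suc s)) (p+s≤O 1+s≤m) ⟩
    E (suc s) + O (suc s)      ≤⟨ E+O≤b (≤‴⇒≤ 1+s≤m) ⟩
    b                          ≤⟨ b≤1+O+E (≤‴⇒≤ 1+s≤m) ⟩
    suc (O s + E (suc s))      ≡⟨ cong suc (+-comm (O s) (E (suc s))) ⟩
    suc (E (suc s) + O s)      ∎))

  O≡p+s : ∀ {s} → s ≤ m → O s ≡ p + s
  O≡p+s {s} s≤m = ≤-antisym (O≤p+s s s≤m) (p+s≤O (≤⇒≤‴ s≤m))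

  E+s+p≡b : ∀ {s} → s ≤ m → E s + s + p ≡ b
  E+s+p≡b {s} s≤m = ≤-antisym (begin
    E s + s + p    ≡⟨ +-assoc (E s) s p ⟩
    E s + (s + p)  ≡⟨ cong (E s +_) (+-comm s p) ⟩
    E s + (p + s)  ≡⟨ cong (E s +_) (O≡p+s s≤m) ⟨
    E s + O s      ≤⟨ E+O≤b s≤m ⟩
    b              ∎) (b≤E+s+p s s≤m)

m+n≡o⇒m≡o∸n : ∀ m {n o} → m + n ≡ o → m ≡ o ∸ n
m+n≡o⇒m≡o∸n m {n} refl = sym (m+n∸n≡m m n)

∷⁴-cong : ∀ {a b c d a′ b′ c′ d′ : ℕ} → a ≡ a′ → b ≡ b′ → c ≡ c′ → d ≡ d′ →
          a ∷ b ∷ c ∷ d ∷ [] ≡ a′ ∷ b′ ∷ c′ ∷ d′ ∷ []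
∷⁴-cong refl refl refl refl = refl

c₃+d₂≡0 : ∀ {p s c₃ d₁ d₂ d₃} → d₁ + d₂ ≡ s → d₁ + d₃ ≡ p + s → c₃ + d₃ ≤ p → c₃ + d₂ ≡ 0
c₃+d₂≡0 {p} {s} {c₃} {d₁} {d₂} {d₃} d₁+d₂≡s d₁+d₃≡p+s c₃+d₃≤p =
  n≤0⇒n≡0 (+-cancelˡ-≤ (d₁ + d₃) (c₃ + d₂) 0 (begin
    (d₁ + d₃) + (c₃ + d₂)  ≡⟨ rearrange d₁ d₃ c₃ d₂ ⟩
    (d₁ + d₂) + (c₃ + d₃)  ≤⟨ +-monoʳ-≤ (d₁ + d₂) c₃+d₃≤p ⟩
    (d₁ + d₂) + p          ≡⟨ cong (_+ p) d₁+d₂≡s ⟩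
    s + p                  ≡⟨ +-comm s p ⟩
    p + s                  ≡⟨ d₁+d₃≡p+s ⟨
    d₁ + d₃                ≡⟨ +-identityʳ (d₁ + d₃) ⟨
    (d₁ + d₃) + 0          ∎))
  where
  open ≤-Reasoning
  rearrange : ∀ a b c d → (a + b) + (c + d) ≡ (a + d) + (c + b)
  rearrange = solve-∀

even-counts : ∀ {b m p s c₁ c₂ c₃ c₄} → m + p ≡ b →
              c₁ + c₂ + s ≡ b → c₁ + c₃ + s + p ≡ b → c₃ ≡ 0 → c₁ + c₂ + c₃ + c₄ ≡ b →
              c₁ ∷ c₂ ∷ c₃ ∷ c₄ ∷ [] ≡ m ∸ s ∷ p ∷ 0 ∷ s ∷ []
even-counts {b} {m} {p} {s} {c₁} {c₂} {c₄ = c₄} m+p≡b c₁+c₂+s≡b c₁+s+p≡b refl total =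
  ∷⁴-cong (m+n≡o⇒m≡o∸n c₁ c₁+s≡m) c₂≡p refl c₄≡s
  where
  open ≡-Reasoning
  c₁+s≡m : c₁ + s ≡ m
  c₁+s≡m = +-cancelʳ-≡ p (c₁ + s) m (begin
    c₁ + s + p      ≡⟨ cong (λ c → c + s + p) (+-identityʳ c₁) ⟨
    c₁ + 0 + s + p  ≡⟨ c₁+s+p≡b ⟩
    b               ≡⟨ m+p≡b ⟨
    m + p           ∎)
  c₂≡p : c₂ ≡ p
  c₂≡p = +-cancelˡ-≡ (c₁ + s) c₂ p (begin
    c₁ + s + c₂     ≡⟨ +-assoc c₁ s c₂ ⟩
    c₁ + (s + c₂)   ≡⟨ cong (c₁ +_) (+-comm s c₂) ⟩
    c₁ + (c₂ + s)   ≡⟨ +-assoc c₁ c₂ s ⟨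
    c₁ + c₂ + s     ≡⟨ c₁+c₂+s≡b ⟩
    b               ≡⟨ m+p≡b ⟨
    m + p           ≡⟨ cong (_+ p) c₁+s≡m ⟨
    c₁ + s + p      ∎)
  c₄≡s : c₄ ≡ s
  c₄≡s = +-cancelˡ-≡ (c₁ + c₂) c₄ s (begin
    c₁ + c₂ + c₄      ≡⟨ cong (_+ c₄) (+-identityʳ (c₁ + c₂)) ⟨
    c₁ + c₂ + 0 + c₄  ≡⟨ total ⟩
    b                 ≡⟨ c₁+c₂+s≡b ⟨
    c₁ + c₂ + s       ∎)

odd-counts : ∀ {b m p s d₁ d₂ d₃ d₄} → m + p ≡ b →
             d₁ + d₂ ≡ s → d₁ + d₃ ≡ p + s → d₂ ≡ 0 → d₁ + d₂ + d₃ + d₄ ≡ b →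
             d₁ ∷ d₂ ∷ d₃ ∷ d₄ ∷ [] ≡ s ∷ 0 ∷ p ∷ m ∸ s ∷ []
odd-counts {b} {m} {p} {s} {d₁} {d₃ = d₃} {d₄} m+p≡b d₁+0≡s d₁+d₃≡p+s refl total =
  ∷⁴-cong d₁≡s refl d₃≡p (m+n≡o⇒m≡o∸n d₄ d₄+s≡m)
  where
  open ≡-Reasoning
  d₁≡s : d₁ ≡ s
  d₁≡s = trans (sym (+-identityʳ d₁)) d₁+0≡s
  d₃≡p : d₃ ≡ p
  d₃≡p = +-cancelˡ-≡ s d₃ p (begin
    s + d₃   ≡⟨ cong (_+ d₃) d₁≡s ⟨
    d₁ + d₃  ≡⟨ d₁+d₃≡p+s ⟩
    p + s    ≡⟨ +-comm p s ⟩
    s + p    ∎)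
  d₄+s≡m : d₄ + s ≡ m
  d₄+s≡m = +-cancelʳ-≡ p (d₄ + s) m (begin
    d₄ + s + p        ≡⟨ rearrange d₄ s p ⟩
    s + 0 + p + d₄    ≡⟨ cong₂ (λ x y → x + 0 + y + d₄) d₁≡s d₃≡p ⟨
    d₁ + 0 + d₃ + d₄  ≡⟨ total ⟩
    b                 ≡⟨ m+p≡b ⟨
    m + p             ∎)
    where
    rearrange : ∀ a b c → a + b + c ≡ b + 0 + c + a
    rearrange = solve-∀

isEven[1+m+m]≡false : ∀ m → isEven (suc (m + m)) ≡ false
isEven[1+m+m]≡false zero    = refl
isEven[1+m+m]≡false (suc m) = trans (cong isEven (+-suc m m)) (isEven[1+m+m]≡false m)

exactlyCompatible-odd : ∀ {a b} k {X Y : Subset a} → isEven k ≡ false →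
                        ExactlyCompatible a b k X Y → ∣ X ∩ Y ∣ ≡ eOf a b * ⌊ k /2⌋
exactlyCompatible-odd k odd compatible with isEven k
exactlyCompatible-odd k ()  compatible | true
exactlyCompatible-odd k odd compatible | false = compatible

exactlyCompatible-2m+1 : ∀ {a b} m {X Y : Subset a} →
                         ExactlyCompatible a b (2 * m + 1) X Y → ∣ X ∩ Y ∣ ≡ eOf a b * m
exactlyCompatible-2m+1 {a} {b} m {X} {Y} compatible =
  trans (exactlyCompatible-odd (suc (m + m)) (isEven[1+m+m]≡false m)
           (subst (λ k → ExactlyCompatible a b k X Y) (2m+1≡1+m+m m) compatible))
        (cong (eOf a b *_) (sym (n≡⌈n+n/2⌉ m)))
  where
  2m+1≡1+m+m : ∀ m → 2 * m + 1 ≡ suc (m + m)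
  2m+1≡1+m+m = solve-∀

2*s≤2*m+1⇒s≤m : ∀ {s m} → 2 * s ≤ 2 * m + 1 → s ≤ m
2*s≤2*m+1⇒s≤m {s} {m} 2s≤2m+1 = ≤-pred (*-cancelˡ-< 2 s (suc m) (begin-strict
  2 * s              ≤⟨ 2s≤2m+1 ⟩
  2 * m + 1          ≡⟨ +-comm (2 * m) 1 ⟩
  suc (2 * m)        <⟨ n<1+n (suc (2 * m)) ⟩
  suc (suc (2 * m))  ≡⟨ *-suc 2 m ⟨
  2 * suc m          ∎))
  where open ≤-Reasoning

module Solution {b m : ℕ} (m≤b : m ≤ b) (φ : Fin (suc (2 * m + 1)) → Subset (2 * b + 1))
  (col : IsColoring (2 * b + 1) b (2 * m + 1) φ)
  (∣A∩B∣≡m : ∣ φ zero ∩ φ (fromℕ (2 * m + 1)) ∣ ≡ m)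
  where

  private
    N : ℕ
    N = 2 * m + 1
    A B : Subset (2 * b + 1)
    A = φ zero
    B = φ (fromℕ N)
    p : ℕ
    p = b ∸ m
    m+p≡b : m + p ≡ b
    m+p≡b = m+[n∸m]≡n m≤b
    vertex : ℕ → Subset (2 * b + 1)
    vertex t = φ (clamp N t)

  trace : Subset (2 * b + 1) → ℕ → ℕ
  trace z t = ∣ vertex t ∩ z ∣

  2*s<N : ∀ {s} → s ≤ m → 2 * s < N
  2*s<N s≤m = ≤-<-trans (*-monoʳ-≤ 2 s≤m) (m<m+n (2 * m) z<s)

  1+2*s<N : ∀ {s} → s < m → suc (2 * s) < N
  1+2*s<N {s} s<m = <-≤-trans (subst (_≤ 2 * m) (*-suc 2 s) (*-monoʳ-≤ 2 s<m)) (m≤m+n (2 * m) 1)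

  trace+trace≤b : ∀ {z} → ∣ z ∣ ≡ b → ∀ {t} → t < N → trace z t + trace z (suc t) ≤ b
  trace+trace≤b {z} ∣z∣≡b {t} t<N =
    subst (trace z t + trace z (suc t) ≤_) ∣z∣≡b
      (∣p∩r∣+∣q∩r∣≤∣r∣ (vertex t) (vertex (suc t)) z (clamp-adjacent-disjoint φ col t<N))

  b≤1+trace+trace : ∀ {z} → ∣ z ∣ ≡ b → ∀ {t} → t < N → b ≤ suc (trace z t + trace z (suc t))
  b≤1+trace+trace ∣z∣≡b {t} t<N =
    b≤1+∣x∩z∣+∣y∩z∣ (proj₁ col (clamp N t)) (proj₁ col (clamp N (suc t))) ∣z∣≡b
      (clamp-adjacent-disjoint φ col t<N)

  module Along {z : Subset (2 * b + 1)} (∣z∣≡b : ∣ z ∣ ≡ b) {q : ℕ}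
    (first : trace z 0 + q ≡ b) (last : trace z (suc (2 * m)) ≡ q + m) =
    Interleaved {b} {q} {m} (λ s → trace z (2 * s)) (λ s → trace z (suc (2 * s)))
      (λ s≤m → trace+trace≤b ∣z∣≡b (2*s<N s≤m))
      (λ {s} s<m → subst (λ t → b ≤ suc (trace z (suc (2 * s)) + trace z t)) (sym (*-suc 2 s))
                     (b≤1+trace+trace ∣z∣≡b (1+2*s<N s<m)))
      first last

  private
    trace-first : ∀ z → trace z 0 ≡ ∣ A ∩ z ∣
    trace-first z = cong (λ v → ∣ φ v ∩ z ∣) (clamp-toℕ zero)

    trace-last : ∀ z → trace z (suc (2 * m)) ≡ ∣ B ∩ z ∣
    trace-last z = cong (λ v → ∣ φ v ∩ z ∣)
      (trans (cong (clamp N) (trans (+-comm 1 (2 * m)) (sym (toℕ-fromℕ N)))) (clamp-toℕ (fromℕ N)))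

    ∣A∣≡b : ∣ A ∣ ≡ b
    ∣A∣≡b = proj₁ col zero

    ∣B∣≡b : ∣ B ∣ ≡ b
    ∣B∣≡b = proj₁ col (fromℕ N)

    ∣B∩A∣≡m : ∣ B ∩ A ∣ ≡ m
    ∣B∩A∣≡m = trans (cong ∣_∣ (∩-comm B A)) ∣A∩B∣≡m

    module AlongA = Along ∣A∣≡b {0}
      (trans (+-identityʳ _) (trans (trace-first A) (trans (cong ∣_∣ (∩-idem A)) ∣A∣≡b)))
      (trans (trace-last A) ∣B∩A∣≡m)

    module AlongB = Along ∣B∣≡b {p}
      (trans (cong (_+ p) (trans (trace-first B) ∣A∩B∣≡m)) m+p≡b)
      (trans (trace-last B) (trans (cong ∣_∣ (∩-idem B)) (trans ∣B∣≡b (trans (sym m+p≡b) (+-comm m p)))))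

    ∣B─A∣≡p : ∣ B ─ A ∣ ≡ p
    ∣B─A∣≡p = m+n≡o⇒m≡o∸n ∣ B ─ A ∣ (begin
      ∣ B ─ A ∣ + m            ≡⟨ +-comm ∣ B ─ A ∣ m ⟩
      m + ∣ B ─ A ∣            ≡⟨ cong₂ _+_ ∣B∩A∣≡m (cong ∣_∣ (sym (p─q≡p∩∁q B A))) ⟨
      ∣ B ∩ A ∣ + ∣ B ∩ ∁ A ∣  ≡⟨ ∣p∩q∣+∣p∩∁q∣≡∣p∣ B A ⟩
      ∣ B ∣                    ≡⟨ ∣B∣≡b ⟩
      b                        ∎)
      where open ≡-Reasoning

    c₃+d₂≡0-at : ∀ {s} → s ≤ m → ∣ vertex (2 * s) ∩ (B ─ A) ∣ + ∣ vertex (suc (2 * s)) ∩ (A ─ B) ∣ ≡ 0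
    c₃+d₂≡0-at {s} s≤m =
      c₃+d₂≡0 {c₃ = ∣ X ∩ (B ─ A) ∣} {∣ Y ∩ (A ∩ B) ∣} {∣ Y ∩ (A ─ B) ∣} {∣ Y ∩ (B ─ A) ∣}
        (trans (∣x∩[p∩q]∣+∣x∩[p─q]∣≡∣x∩p∣ Y A B) (AlongA.O≡p+s s≤m))
        (trans (∣x∩[p∩q]∣+∣x∩[q─p]∣≡∣x∩q∣ Y A B) (AlongB.O≡p+s s≤m))
        (subst (∣ X ∩ (B ─ A) ∣ + ∣ Y ∩ (B ─ A) ∣ ≤_) ∣B─A∣≡p
          (∣p∩r∣+∣q∩r∣≤∣r∣ X Y (B ─ A) (clamp-adjacent-disjoint φ col (2*s<N s≤m))))
      where
      X Y : Subset (2 * b + 1)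
      X = vertex (2 * s)
      Y = vertex (suc (2 * s))

    cvec-clamp-even : ∀ {s} → s ≤ m → cvec φ (clamp N (2 * s)) ≡ m ∸ s ∷ p ∷ 0 ∷ s ∷ []
    cvec-clamp-even {s} s≤m = even-counts m+p≡b
      (trans (cong (_+ s) (∣x∩[p∩q]∣+∣x∩[p─q]∣≡∣x∩p∣ X A B))
             (trans (sym (+-identityʳ _)) (AlongA.E+s+p≡b s≤m)))
      (trans (cong (λ c → c + s + p) (∣x∩[p∩q]∣+∣x∩[q─p]∣≡∣x∩q∣ X A B)) (AlongB.E+s+p≡b s≤m))
      (m+n≡0⇒m≡0 _ (c₃+d₂≡0-at s≤m))
      (trans (∣x∩[p∩q]∣+∣x∩[p─q]∣+∣x∩[q─p]∣+∣x∩∁[p∪q]∣≡∣x∣ X A B) (proj₁ col (clamp N (2 * s))))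
      where X = vertex (2 * s)

    cvec-clamp-odd : ∀ {s} → s ≤ m → cvec φ (clamp N (suc (2 * s))) ≡ s ∷ 0 ∷ p ∷ m ∸ s ∷ []
    cvec-clamp-odd {s} s≤m = odd-counts m+p≡b
      (trans (∣x∩[p∩q]∣+∣x∩[p─q]∣≡∣x∩p∣ Y A B) (AlongA.O≡p+s s≤m))
      (trans (∣x∩[p∩q]∣+∣x∩[q─p]∣≡∣x∩q∣ Y A B) (AlongB.O≡p+s s≤m))
      (m+n≡0⇒n≡0 _ (c₃+d₂≡0-at s≤m))
      (trans (∣x∩[p∩q]∣+∣x∩[p─q]∣+∣x∩[q─p]∣+∣x∩∁[p∪q]∣≡∣x∣ Y A B) (proj₁ col (clamp N (suc (2 * s)))))
      where Y = vertex (suc (2 * s))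

    cvec-at : ∀ (k : Fin (suc N)) {t} → toℕ k ≡ t → cvec φ k ≡ cvec φ (clamp N t)
    cvec-at k refl = cong (cvec φ) (sym (clamp-toℕ k))

  cvec-even : ∀ (k : Fin (suc N)) {s} → toℕ k ≡ 2 * s → cvec φ k ≡ m ∸ s ∷ b ∸ m ∷ 0 ∷ s ∷ []
  cvec-even k k≡2s =
    trans (cvec-at k k≡2s) (cvec-clamp-even (2*s≤2*m+1⇒s≤m (subst (_≤ N) k≡2s (toℕ≤pred[n] k))))

  cvec-odd : ∀ (k : Fin (suc N)) {s} → toℕ k ≡ 2 * s + 1 → cvec φ k ≡ s ∷ 0 ∷ b ∸ m ∷ m ∸ s ∷ []
  cvec-odd k {s} k≡2s+1 =
    trans (cvec-at k (trans k≡2s+1 (+-comm (2 * s) 1)))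
      (cvec-clamp-odd (2*s≤2*m+1⇒s≤m (≤-trans (m≤m+n (2 * s) 1) (subst (_≤ N) k≡2s+1 (toℕ≤pred[n] k)))))

proposition4 : (b m : ℕ) → 1 ≤ b → eOf (2 * b + 1) b * m ≤ b →
    (φ : Fin (suc (2 * m + 1)) → Subset (2 * b + 1)) →
    IsColoring (2 * b + 1) b (2 * m + 1) φ →
    ExactlyCompatible (2 * b + 1) b (2 * m + 1) (φ Data.Fin.zero) (φ (Data.Fin.fromℕ (2 * m + 1))) →
    (k : Fin (suc (2 * m + 1))) → (s : ℕ) →
    (toℕ k ≡ 2 * s →
      cvec φ k ≡ eOf (2 * b + 1) b * (m ∸ s) ∷ b ∸ eOf (2 * b + 1) b * m ∷ 0 ∷ eOf (2 * b + 1) b * s ∷ []) ×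
    (toℕ k ≡ 2 * s + 1 →
      cvec φ k ≡ eOf (2 * b + 1) b * s ∷ 0 ∷ b ∸ eOf (2 * b + 1) b * m ∷ eOf (2 * b + 1) b * (m ∸ s) ∷ [])
proposition4 b m _ e*m≤b φ col compatible k s =
  (λ k≡2s → trans (cvec-even k k≡2s) (sym (∷⁴-cong (e*x≡x (m ∸ s)) (cong (b ∸_) (e*x≡x m)) refl (e*x≡x s)))) ,
  (λ k≡2s+1 → trans (cvec-odd k k≡2s+1) (sym (∷⁴-cong (e*x≡x s) refl (cong (b ∸_) (e*x≡x m)) (e*x≡x (m ∸ s)))))
  where
  e*x≡x : ∀ x → eOf (2 * b + 1) b * x ≡ x
  e*x≡x x = trans (cong (_* x) (m+n∸m≡n (2 * b) 1)) (*-identityˡ x)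
  open Solution (subst (_≤ b) (e*x≡x m) e*m≤b) φ col (trans (exactlyCompatible-2m+1 m compatible) (e*x≡x m))
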